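{- Let $k \ge 1$ and let $S \subseteq V$ be any set of nodes of the communication network $G=(V,E)$. Suppose each node has an $a$-bit identifier that is unique within distance $k$, and messages have $\mathsf{bandwidth}$ bits. Then every $v \in V$ can learn whether there exists some $w \in N^k(v,S)$ with $w \neq v$, in $\widetilde{O}(k \cdot \lceil a / \mathsf{bandwidth}\rceil)$ rounds.
   Context: Synchronous message passing on $G$: each round each node may send a $\mathsf{bandwidth}$-bit message to each neighbor. $N^k(v)$ is the set of nodes $w\neq v$ with $\operatorname{dist}_G(v,w)\le k$ and $N^k(v,S)=N^k(v)\cap S$. $\widetilde{O}(x)$ hides factors logarithmic in $x$. -}

module Defs where

open import Data.Nat using (ℕ; zero; suc; _+_; _*_; _∸_; _^_; _≤_; NonZero)
open import Data.Nat.DivMod using (_/_)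
open import Data.Nat.Logarithm using (⌈log₂_⌉)
open import Data.Fin using (Fin)
open import Data.Fin.Subset using (Subset; _∈_)
open import Data.Bool using (Bool; true; false)
open import Data.Maybe using (Maybe; just; nothing)
open import Data.Vec using (Vec; lookup)
open import Data.Product using (Σ; ∃; _×_; _,_)
open import Relation.Binary.PropositionalEquality using (_≡_; _≢_)
open import Function.Bundles using (_⇔_)

-- Communication network: a finite simple undirected graph, given with
-- a port numbering (node v reaches its deg v neighbours via ports).

record Network : Set where
  field
    n        : ℕ
    deg      : Fin n → ℕ
    nbr      : (v : Fin n) → Fin (deg v) → Fin n
    back     : (v : Fin n) (p : Fin (deg v)) → Fin (deg (nbr v p))
    nbr-back : ∀ v p → nbr (nbr v p) (back v p) ≡ v
    no-loop  : ∀ v p → nbr v p ≢ v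
    nbr-inj  : ∀ v p q → nbr v p ≡ nbr v q → p ≡ q

open Network public

-- Walk G k v w : there is a walk of length ≤ k from v to w,
-- i.e. dist_G(v,w) ≤ k.
data Walk (G : Network) : ℕ → Fin (n G) → Fin (n G) → Set where
  here : ∀ {k v} → Walk G k v v
  step : ∀ {k v w} (p : Fin (deg G v)) → Walk G k (nbr G v p) w → Walk G (suc k) v w

InNk : (G : Network) (k : ℕ) (v : Fin (n G)) (S : Subset (n G)) → Fin (n G) → Set
InNk G k v S w = (w ≢ v) × Walk G k v w × (w ∈ S)

IdsUniqueWithin : (G : Network) (k a : ℕ) → (Fin (n G) → Vec Bool a) → Set
IdsUniqueWithin G k a ids = ∀ v w → v ≢ w → Walk G k v w → ids v ≢ ids w

-- Deterministic synchronous message passing with bandwidth B: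
-- each round each node sends to each neighbour either nothing or a
-- B-bit message, receives, then updates its (unbounded) local state.

Msg : ℕ → Set
Msg B = Maybe (Vec Bool B)

record Protocol (a B : ℕ) : Set₁ where
  field
    State  : ℕ → Set                         -- indexed by the node degree
    init   : (d : ℕ) → Vec Bool a → Bool → State d   -- identifier, membership in S
    send   : ∀ {d} → State d → Fin d → Msg B
    recv   : ∀ {d} → State d → (Fin d → Msg B) → State d
    output : ∀ {d} → State d → Maybe Bool

-- A (uniform) algorithm knows the parameters k, a and bandwidth B.
Algorithm : Set₁
Algorithm = (k a B : ℕ) → Protocol a B

module Run {a B : ℕ} (P : Protocol a B) (G : Network) where
  open Protocol P

  Config : Set
  Config = (v : Fin (n G)) → State (deg G v)

  round : Config → Config
  round c v = recv (c v) (λ p → send (c (nbr G v p)) (back G v p))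

  run : (ids : Fin (n G) → Vec Bool a) (S : Subset (n G)) → ℕ → Config
  run ids S zero    v = init (deg G v) (ids v) (lookup S v)
  run ids S (suc t) = round (run ids S t)

AllCorrectAt : ∀ {a B} (P : Protocol a B) (G : Network) (k : ℕ)
  (ids : Fin (n G) → Vec Bool a) (S : Subset (n G)) (t : ℕ) → Set
AllCorrectAt P G k ids S t =
  ∀ v → Σ Bool λ b →
    (Protocol.output P (Run.run P G ids S t v) ≡ just b)
    × ((b ≡ true) ⇔ (∃ λ w → InNk G k v S w))

ceilDiv : (a B : ℕ) → .{{NonZero B}} → ℕ
ceilDiv a B = (a + B ∸ 1) / B

softO : (c x : ℕ) → ℕ
softO c x = c * x * (1 + ⌈log₂ x ⌉) ^ c

{-# OPTIONS --safe #-}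
-- Cut every a-bit identifier into ⌈a/B⌉ chunks of B positions; for a chunk j and a bit value c,
-- the (j , c)-flags of a node in S mark the positions of chunk j at which its identifier has value c
-- (nodes outside S have no flags).  Flooding the bitwise OR of these 2⌈a/B⌉ flag vectors for k hops
-- tells v, for every position and value, whether a node of S within distance k has that value there.
-- As identifiers are unique within distance k, N^k(v,S) ∖ {v} is nonempty iff some flooded bit is not
-- among v's own flags.  Each node keeps its flag vectors in a queue: it sends the head and re-appends it
-- OR-ed with the heads of its neighbours.  All queues rotate in lockstep, so one rotation (2⌈a/B⌉
-- rounds) advances every flood by one hop, and k rotations suffice.
module Submission where

open import Defs
open import Data.Nat using (ℕ; zero; suc; _+_; _*_; _∸_; _≤_; _<_; _≟_; NonZero)
open import Data.Nat.Properties
  using (+-suc; +-comm; +-identityʳ; *-distribˡ-+; +-monoˡ-≤; +-cancelʳ-≤; <⇒≤pred; <-≤-trans;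
         m≤m*n; m^n≢0; module ≤-Reasoning)
open import Data.Nat.DivMod using (_/_; _%_; m≡m%n+[m/n]*n; m%n<n; m<n*o⇒m/o<n)
open import Data.Nat.GeneralisedArithmetic using (fold; iterate)
open import Data.Nat.Logarithm using (⌈log₂_⌉)
open import Data.Fin using (Fin; zero; suc; toℕ; fromℕ<)
open import Data.Fin.Properties using (toℕ-fromℕ<; toℕ-injective; toℕ<n; ¬∀⟶∃¬; ⊎⇔∃)
  renaming (any? to anyFin?)
open import Data.Fin.Subset using (Subset)
open import Data.Bool using (Bool; true; false; _∨_; _∧_; T)
open import Data.Bool.Properties using (T-≡; T-∧; T-∨) renaming (_≟_ to _≟ᵇ_)
open import Data.Maybe using (just; fromMaybe) renaming (map to mapMaybe)
open import Data.Vec using (Vec; lookup; tabulate; zipWith; replicate)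
open import Data.Vec.Properties
  using (lookup∘tabulate; tabulate∘lookup; tabulate-cong; lookup-zipWith; lookup-replicate; lookup⇒[]=; []=⇒lookup)
import Data.Vec.Functional as Vector
open import Data.List using (List; []; _∷_; _++_; _∷ʳ_; map; length; head; allFin)
open import Data.List.Properties using (map-++; map-∘; ++-assoc; ++-identityʳ; ∷ʳ-++; length-map; length-++; length-tabulate)
open import Data.List.Relation.Unary.Any using (Any; any?; satisfied)
open import Data.List.Relation.Unary.Any.Properties using (map⁺; map⁻)
import Data.List.Membership.Propositional as List
open import Data.List.Membership.Propositional using (lose)
open import Data.List.Membership.Propositional.Properties using (∈-allFin; ∈-map⁺; ∈-++⁺ˡ; ∈-++⁺ʳ)
open import Data.Product using (Σ; ∃; ∃₂; _×_; _,_; proj₁; proj₂; map₁; map₂)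
open import Data.Sum using (_⊎_; inj₁; inj₂)
open import Data.Sum.Function.Propositional using (_⊎-⇔_)
open import Data.Product.Function.NonDependent.Propositional using (_×-⇔_)
open import Data.Empty using (⊥-elim)
open import Function using (_∘_; _⇔_; mk⇔; Equivalence)
open import Function.Properties.Equivalence using () renaming (refl to ⇔-refl; trans to ⇔-trans)
open import Relation.Nullary using (¬_; Dec; does; yes; no)
open import Relation.Nullary.Decidable using (_×-dec_; ¬?; T?)
open import Relation.Binary.PropositionalEquality
  using (_≡_; _≢_; _≗_; refl; sym; trans; cong; cong₂; subst; module ≡-Reasoning)

open Equivalence using (to; from)

walk-weaken : ∀ {G k v w} → Walk G k v w → Walk G (suc k) v w
walk-weaken here          = here
walk-weaken (step p walk) = step p (walk-weaken walk)

does⇔ : ∀ {p} {P : Set p} (P? : Dec P) → (does P? ≡ true) ⇔ P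
does⇔ (yes p)  = mk⇔ (λ _ → p) (λ _ → refl)
does⇔ (no ¬p)  = mk⇔ (λ ()) (λ p → ⊥-elim (¬p p))

⋁ : ∀ {B d} → (Fin d → Vec Bool B) → Vec Bool B
⋁ = Vector.foldr (zipWith _∨_) (replicate _ false)

⋁-cong : ∀ {B d} {f g : Fin d → Vec Bool B} → f ≗ g → ⋁ f ≡ ⋁ g
⋁-cong {d = zero}  _   = refl
⋁-cong {d = suc d} f≗g = cong₂ (zipWith _∨_) (f≗g zero) (⋁-cong (f≗g ∘ suc))

T-⋁ : ∀ {B d} (f : Fin d → Vec Bool B) s → T (lookup (⋁ f) s) ⇔ ∃ λ q → T (lookup (f q) s)
T-⋁ {d = zero} f s rewrite lookup-replicate s false = mk⇔ (λ ()) (λ ())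
T-⋁ {d = suc d} f s rewrite lookup-zipWith _∨_ s (f zero) (⋁ (f ∘ suc)) =
  ⇔-trans T-∨ (⇔-trans (⇔-refl ⊎-⇔ T-⋁ (f ∘ suc) s) ⊎⇔∃)

module Flooding (G : Network) {B : ℕ} where

  Column : Set
  Column = Fin (n G) → Vec Bool B

  spread : Column → Column
  spread col v = zipWith _∨_ (col v) (⋁ λ q → col (nbr G v q))

  flood : ℕ → Column → Column
  flood r col = fold col spread r

  T-spread : ∀ col v s →
    T (lookup (spread col v) s) ⇔ (T (lookup (col v) s) ⊎ ∃ λ q → T (lookup (col (nbr G v q)) s))
  T-spread col v s rewrite lookup-zipWith _∨_ s (col v) (⋁ λ q → col (nbr G v q)) =
    ⇔-trans T-∨ (⇔-refl ⊎-⇔ T-⋁ (λ q → col (nbr G v q)) s)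

  flood⁺ : ∀ {r col v w} s → Walk G r v w → T (lookup (col w) s) → T (lookup (flood r col v) s)
  flood⁺ {zero}          s here          t = t
  flood⁺ {suc r} {col} {v} s here        t = from (T-spread (flood r col) v s) (inj₁ (flood⁺ {r} {col} s here t))
  flood⁺ {suc r} {col} {v} s (step q wk) t = from (T-spread (flood r col) v s) (inj₂ (q , flood⁺ {r} {col} s wk t))

  flood⁻ : ∀ r col v s → T (lookup (flood r col v) s) → ∃ λ w → Walk G r v w × T (lookup (col w) s)
  flood⁻ zero    col v s t = v , here , t
  flood⁻ (suc r) col v s t with to (T-spread (flood r col) v s) t
  ... | inj₁ t′       = map₂ (map₁ walk-weaken) (flood⁻ r col v s t′)
  ... | inj₂ (q , t′) = map₂ (map₁ (step q)) (flood⁻ r col (nbr G v q) s t′)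

HasBit : ∀ {a} → Vec Bool a → ℕ → Bool → Set
HasBit x p c = ∃ λ i → toℕ i ≡ p × lookup x i ≡ c

hasBit? : ∀ {a} (x : Vec Bool a) p c → Dec (HasBit x p c)
hasBit? x p c = anyFin? λ i → (toℕ i ≟ p) ×-dec (lookup x i ≟ᵇ c)

HasBit-toℕ : ∀ {a} {x : Vec Bool a} {i c} → HasBit x (toℕ i) c → lookup x i ≡ c
HasBit-toℕ (_ , eq , xi≡c) rewrite toℕ-injective eq = xi≡c

lookup-extensionality : ∀ {a} {x y : Vec Bool a} → (∀ i → lookup x i ≡ lookup y i) → x ≡ y
lookup-extensionality {x = x} {y} eq = trans (sym (tabulate∘lookup x)) (trans (tabulate-cong eq) (tabulate∘lookup y))

differing-index : ∀ {a} {x y : Vec Bool a} → x ≢ y → ∃ λ i → lookup x i ≢ lookup y i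
differing-index {a} {x} {y} x≢y = ¬∀⟶∃¬ a _ (λ i → lookup x i ≟ᵇ lookup y i) (x≢y ∘ lookup-extensionality {x = x})

ceilDiv-covers : ∀ a b → a ≤ ceilDiv a (suc b) * suc b
ceilDiv-covers a b = +-cancelʳ-≤ b a (x / suc b * suc b) (begin
    a + b                         ≡⟨ cong (_∸ 1) (+-suc a b) ⟨
    x                             ≡⟨ m≡m%n+[m/n]*n x (suc b) ⟩
    x % suc b + x / suc b * suc b  ≤⟨ +-monoˡ-≤ _ (<⇒≤pred (m%n<n x (suc b))) ⟩
    b + x / suc b * suc b          ≡⟨ +-comm b _ ⟩
    x / suc b * suc b + b          ∎)
  where
  open ≤-Reasoning
  x = a + suc b ∸ 1

module Chunking {a B m : ℕ} .{{_ : NonZero B}} (covers : a ≤ m * B) where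

  chunk-coordinates : ∀ {p} → p < a → ∃₂ λ (j : Fin m) (s : Fin B) → toℕ s + toℕ j * B ≡ p
  chunk-coordinates {p} p<a = fromℕ< p/B<m , fromℕ< p%B<B , (begin
      toℕ (fromℕ< p%B<B) + toℕ (fromℕ< p/B<m) * B  ≡⟨ cong₂ (λ s j → s + j * B) (toℕ-fromℕ< p%B<B) (toℕ-fromℕ< p/B<m) ⟩
      p % B + p / B * B                            ≡⟨ m≡m%n+[m/n]*n p B ⟨
      p                                            ∎)
    where
    open ≡-Reasoning
    p/B<m : p / B < m
    p/B<m = m<n*o⇒m/o<n (<-≤-trans p<a covers)
    p%B<B : p % B < B
    p%B<B = m%n<n p B

  separating-chunk : ∀ {x y : Vec Bool a} → x ≢ y →
    ∃₂ λ (j : Fin m) (s : Fin B) → ∃ λ c → HasBit x (toℕ s + toℕ j * B) c × ¬ HasBit y (toℕ s + toℕ j * B) c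
  separating-chunk {x} {y} x≢y with differing-index {x = x} {y} x≢y
  ... | i , xi≢yi with chunk-coordinates (toℕ<n i)
  ... | j , s , pos = j , s , lookup x i , (i , sym pos , refl) ,
                      λ y-has → xi≢yi (sym (HasBit-toℕ {x = y} (subst (λ p → HasBit y p (lookup x i)) pos y-has)))

module Detector (a B m : ℕ) where

  Chunk : Set
  Chunk = Fin m × Bool

  chunks : List Chunk
  chunks = map (_, true) (allFin m) ++ map (_, false) (allFin m)

  chunks-complete : ∀ ch → ch List.∈ chunks
  chunks-complete (j , true)  = ∈-++⁺ˡ (∈-map⁺ (_, true) (∈-allFin j))
  chunks-complete (j , false) = ∈-++⁺ʳ (map (_, true) (allFin m)) (∈-map⁺ (_, false) (∈-allFin j))

  length-chunks : length chunks ≡ m + m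
  length-chunks = begin
    length chunks                                          ≡⟨ length-++ (map (_, true) (allFin m)) ⟩
    length (map (_, true) (allFin m)) + length (map (_, false) (allFin m))
      ≡⟨ cong₂ _+_ (length-map (_, true) (allFin m)) (length-map (_, false) (allFin m)) ⟩
    length (allFin m) + length (allFin m)                  ≡⟨ cong₂ _+_ length-allFin length-allFin ⟩
    m + m                                                  ∎
    where
    open ≡-Reasoning
    length-allFin : length (allFin m) ≡ m
    length-allFin = length-tabulate (λ i → i)

  Entry : Set
  Entry = Vec Bool B

  seed : Bool → Vec Bool a → Chunk → Entry
  seed b x (j , c) = tabulate λ s → b ∧ does (hasBit? x (toℕ s + toℕ j * B) c)

  T-seed : ∀ b x j c s → T (lookup (seed b x (j , c)) s) ⇔ (T b × HasBit x (toℕ s + toℕ j * B) c)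
  T-seed b x j c s rewrite lookup∘tabulate (λ s → b ∧ does (hasBit? x (toℕ s + toℕ j * B) c)) s =
    ⇔-trans T-∧ (⇔-refl ×-⇔ ⇔-trans T-≡ (does⇔ (hasBit? x (toℕ s + toℕ j * B) c)))

  record State : Set where
    field
      own   : Chunk → Entry
      queue : List (Chunk × Entry)
  open State public

  merge : ∀ {d} → Entry → (Fin d → Msg B) → Entry
  merge e msgs = zipWith _∨_ e (⋁ (fromMaybe (replicate B false) ∘ msgs))

  rotate : ∀ {d} → (Fin d → Msg B) → List (Chunk × Entry) → List (Chunk × Entry)
  rotate msgs []             = []
  rotate msgs ((ch , e) ∷ q) = q ∷ʳ (ch , merge e msgs)

  Surplus : (Chunk → Entry) → Chunk × Entry → Set
  Surplus own (ch , e) = ∃ λ s → T (lookup e s) × ¬ T (lookup (own ch) s)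

  surplus? : ∀ own x → Dec (Surplus own x)
  surplus? own (ch , e) = anyFin? λ s → T? (lookup e s) ×-dec ¬? (T? (lookup (own ch) s))

  protocol : Protocol a B
  protocol = record
    { State  = λ _ → State
    ; init   = λ _ x b → record { own = seed b x ; queue = map (λ ch → ch , seed b x ch) chunks }
    ; send   = λ st _ → mapMaybe proj₂ (head (queue st))
    ; recv   = λ st msgs → record st { queue = rotate msgs (queue st) }
    ; output = λ st → just (does (any? (surplus? (own st)) (queue st)))
    }

module Execution {a B m : ℕ} (G : Network) (S : Subset (n G)) (ids : Fin (n G) → Vec Bool a) where
  open Detector a B m
  open Flooding G {B}
  open Run protocol G

  -- The queues of all nodes are described by one list of chunk-labelled columns, node v holding
  -- their values at v; this keeps the heads exchanged by neighbours on the same chunk.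
  at : Fin (n G) → Chunk × Column → Chunk × Entry
  at v = map₂ λ col → col v

  round-rotates : ∀ {ch col} Zs (c : Config) → (∀ v → queue (c v) ≡ map (at v) ((ch , col) ∷ Zs)) →
    ∀ v → queue (round c v) ≡ map (at v) (Zs ∷ʳ (ch , spread col))
  round-rotates {ch} {col} Zs c aligned v = begin
    rotate msgs (queue (c v))                   ≡⟨ cong (rotate msgs) (aligned v) ⟩
    map (at v) Zs ∷ʳ (ch , merge (col v) msgs)  ≡⟨ cong (λ e → map (at v) Zs ∷ʳ (ch , e)) merge-spreads ⟩
    map (at v) Zs ∷ʳ (ch , spread col v)        ≡⟨ map-++ (at v) Zs _ ⟨
    map (at v) (Zs ∷ʳ (ch , spread col))        ∎
    where
    open ≡-Reasoning
    msgs : Fin (deg G v) → Msg B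
    msgs q = Protocol.send protocol (c (nbr G v q)) (back G v q)
    merge-spreads : merge (col v) msgs ≡ spread col v
    merge-spreads = cong (zipWith _∨_ (col v)) (⋁-cong λ q →
      cong (fromMaybe (replicate B false) ∘ mapMaybe proj₂ ∘ head) (aligned (nbr G v q)))

  rounds-rotate : ∀ Xs Ys (c : Config) → (∀ v → queue (c v) ≡ map (at v) (Xs ++ Ys)) →
    ∀ v → queue (iterate round c (length Xs) v) ≡ map (at v) (Ys ++ map (map₂ spread) Xs)
  rounds-rotate []                Ys c aligned v =
    trans (aligned v) (cong (map (at v)) (sym (++-identityʳ Ys)))
  rounds-rotate ((ch , col) ∷ Xs) Ys c aligned v = begin
    queue (iterate round (round c) (length Xs) v)                      ≡⟨ rounds-rotate Xs _ (round c) aligned′ v ⟩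
    map (at v) ((Ys ∷ʳ (ch , spread col)) ++ map (map₂ spread) Xs)     ≡⟨ cong (map (at v)) (∷ʳ-++ Ys _ _) ⟩
    map (at v) (Ys ++ map (map₂ spread) ((ch , col) ∷ Xs))             ∎
    where
    open ≡-Reasoning
    aligned′ : ∀ v → queue (round c v) ≡ map (at v) (Xs ++ (Ys ∷ʳ (ch , spread col)))
    aligned′ w = trans (round-rotates (Xs ++ Ys) c aligned w) (cong (map (at w)) (++-assoc Xs Ys _))

  phase-spreads : ∀ Xs (c : Config) → (∀ v → queue (c v) ≡ map (at v) Xs) →
    ∀ v → queue (iterate round c (length Xs) v) ≡ map (at v) (map (map₂ spread) Xs)
  phase-spreads Xs c aligned =
    rounds-rotate Xs [] c λ v → trans (aligned v) (cong (map (at v)) (sym (++-identityʳ Xs)))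

  seedColumn : Chunk → Column
  seedColumn ch w = seed (lookup S w) (ids w) ch

  columns : ℕ → List (Chunk × Column)
  columns r = map (λ ch → ch , flood r (seedColumn ch)) chunks

  run-+ : ∀ l t → run ids S (l + t) ≡ iterate round (run ids S t) l
  run-+ zero    t = refl
  run-+ (suc l) t = trans (cong (run ids S) (sym (+-suc l t))) (run-+ l (suc t))

  queue-run : ∀ r v → queue (run ids S (r * length chunks) v) ≡ map (at v) (columns r)
  queue-run zero    v = map-∘ chunks
  queue-run (suc r) v = begin
    queue (run ids S (L + r * L) v)                              ≡⟨ cong (λ c → queue (c v)) (run-+ L (r * L)) ⟩
    queue (iterate round (run ids S (r * L)) L v)
      ≡⟨ cong (λ l → queue (iterate round (run ids S (r * L)) l v)) (length-map _ chunks) ⟨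
    queue (iterate round (run ids S (r * L)) (length (columns r)) v)  ≡⟨ phase-spreads (columns r) _ (queue-run r) v ⟩
    map (at v) (map (map₂ spread) (columns r))                   ≡⟨ cong (map (at v)) (map-∘ chunks) ⟨
    map (at v) (columns (suc r))                                 ∎
    where
    open ≡-Reasoning
    L = length chunks

  own-run : ∀ t v → own (run ids S t v) ≡ seed (lookup S v) (ids v)
  own-run zero    v = refl
  own-run (suc t) v = own-run t v

  Detects : ℕ → Fin (n G) → Set
  Detects k v = ∃ λ ch → Surplus (seed (lookup S v) (ids v)) (ch , flood k (seedColumn ch) v)

  output-detects : ∀ k v → let st = run ids S (k * length chunks) v in
    Any (Surplus (own st)) (queue st) ⇔ Detects k v
  output-detects k v rewrite queue-run k v | own-run (k * length chunks) v =
    mk⇔ (satisfied ∘ map⁻ ∘ map⁻) λ (ch , surplus) → map⁺ (map⁺ (lose (chunks-complete ch) surplus))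

  module _ .{{_ : NonZero B}} (covers : a ≤ m * B) where
    open Chunking {a} {B} {m} covers

    detects⇔neighbour : ∀ {k} → IdsUniqueWithin G k a ids → ∀ v → Detects k v ⇔ ∃ (InNk G k v S)
    detects⇔neighbour {k} unique v = mk⇔ neighbour detects
      where
      neighbour : Detects k v → ∃ (InNk G k v S)
      neighbour ((j , c) , s , flooded , ¬own) with flood⁻ k (seedColumn (j , c)) v s flooded
      ... | w , walk , seeded =
        w , (λ { refl → ¬own seeded }) , walk ,
        lookup⇒[]= w S (to T-≡ (proj₁ (to (T-seed (lookup S w) (ids w) j c s) seeded)))
      detects : ∃ (InNk G k v S) → Detects k v
      detects (w , w≢v , walk , w∈S) with separating-chunk (unique v w (w≢v ∘ sym) walk ∘ sym)
      ... | j , s , c , w-has , ¬v-has =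
        (j , c) , s ,
        flood⁺ s walk (from (T-seed (lookup S w) (ids w) j c s) (from T-≡ ([]=⇒lookup w∈S) , w-has)) ,
        ¬v-has ∘ proj₂ ∘ to (T-seed (lookup S v) (ids v) j c s)

    correct : ∀ {k} → IdsUniqueWithin G k a ids → AllCorrectAt protocol G k ids S (k * length chunks)
    correct {k} unique v =
      does detect? , refl , ⇔-trans (does⇔ detect?) (⇔-trans (output-detects k v) (detects⇔neighbour unique v))
      where
      st = run ids S (k * length chunks) v
      detect? = any? (surplus? (own st)) (queue st)

≤-softO : ∀ c x → c * x ≤ softO c x
≤-softO c x = m≤m*n (c * x) _ {{m^n≢0 (1 + ⌈log₂ x ⌉) c}}

-- Bandwidth 0 is excluded by the theorem; the chunk count chosen for it is irrelevant.
chunkCount : ℕ → ℕ → ℕ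
chunkCount a zero      = 0
chunkCount a B@(suc _) = ceilDiv a B

detector : Algorithm
detector k a B = Detector.protocol a B (chunkCount a B)

detector-correct : ∀ (k a B : ℕ) → 1 ≤ k → .{{_ : NonZero B}} →
  (G : Network) (S : Subset (n G)) (ids : Fin (n G) → Vec Bool a) →
  IdsUniqueWithin G k a ids →
  Σ ℕ λ T → (T ≤ softO 2 (k * ceilDiv a B)) × AllCorrectAt (detector k a B) G k ids S T
detector-correct k a B@(suc b) _ G S ids unique =
  k * length chunks , rounds-bound , Execution.correct G S ids (ceilDiv-covers a b) unique
  where
  open Detector a B (ceilDiv a B)
  open ≤-Reasoning
  m = ceilDiv a B
  rounds-bound : k * length chunks ≤ softO 2 (k * m)
  rounds-bound = begin
    k * length chunks  ≡⟨ cong (k *_) length-chunks ⟩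
    k * (m + m)        ≡⟨ *-distribˡ-+ k m m ⟩
    k * m + k * m      ≡⟨ cong (k * m +_) (+-identityʳ (k * m)) ⟨
    2 * (k * m)        ≤⟨ ≤-softO 2 (k * m) ⟩
    softO 2 (k * m)    ∎

lemma8p2 : Σ Algorithm λ A → Σ ℕ λ c →
    ∀ (k a B : ℕ) → 1 ≤ k → .{{_ : NonZero B}} →
    (G : Network) (S : Subset (n G)) (ids : Fin (n G) → Vec Bool a) →
    IdsUniqueWithin G k a ids →
    Σ ℕ λ T → (T ≤ softO c (k * ceilDiv a B)) × AllCorrectAt (A k a B) G k ids S T
lemma8p2 = detector , 2 , detector-correct
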